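{- Let $k\ge 2$ and let $G,H$ be finite simple undirected graphs. Every solution to $\mathsf{L}^{k+1}_{\mathrm{iso}}(G,H)$ is a solution to $\widetilde{\mathsf{F}}^{k+1/2}_{\mathrm{iso}}(G,H)$.
   Context: Let $V=V(G)$, $W=V(H)$ with adjacency matrices $A,B$. A set $\pi=\{(v_1,w_1),\dots,(v_\ell,w_\ell)\}\subseteq V\times W$ is a partial isomorphism if for all $i,j$: $v_i=v_j\iff w_i=w_j$ and $v_iv_j\in E(G)\iff w_iw_j\in E(H)$. Both systems below have the variables $X_\pi$ for $\pi\subseteq V\times W$ with $|\pi|\le k+1$. $\mathsf{L}^{k+1}_{\mathrm{iso}}(G,H)$: (L1) $\sum_{v\in V}X_{\pi\cup\{(v,w)\}}=X_\pi$ for all $|\pi|\le k$ and $w\in W$; (L2) $\sum_{w\in W}X_{\pi\cup\{(v,w)\}}=X_\pi$ for all $|\pi|\le k$ and $v\in V$; (L3) $X_\pi=0$ for all $|\pi|\le k+1$ that are not partial isomorphisms from $G$ to $H$; (L4) $X_\emptyset=1$. $\widetilde{\mathsf{F}}^{k+1/2}_{\mathrm{iso}}(G,H)$: the equations (L1), (L2), (L4), together with $\sum_{v'\in V}A_{vv'}X_{\pi\cup\{(v',w)\}}=\sum_{w'\in W}X_{\pi\cup\{(v,w')\}}B_{w'w}$ for all $\pi\subseteq V\times W$ with $|\pi|\le k-1$ and all $v\in V$, $w\in W$. -}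

module Defs where

open import Level using (Level)
open import Data.Nat using (ℕ; _≤_; _∸_; suc) renaming (_*_ to _*ℕ_)
open import Data.Bool using (Bool; true; false; if_then_else_)
open import Data.Fin using (Fin; combine)
open import Data.Fin.Subset using (Subset; _∈_; _∪_; ⁅_⁆; ∣_∣; ⊥)
open import Data.Product using (_×_)
open import Function.Bundles using (_⇔_)
open import Relation.Binary.PropositionalEquality using (_≡_)
open import Relation.Nullary using (¬_)
open import Algebra.Bundles using (CommutativeRing)
import Algebra.Properties.Monoid.Sum as MonoidSum

record SimpleGraph (n : ℕ) : Set where
  field
    adj     : Fin n → Fin n → Bool
    sym     : ∀ u v → adj u v ≡ adj v u
    irrefl  : ∀ v → adj v v ≡ false

open SimpleGraph public

-- Subsets π ⊆ V × W, with V = Fin n, W = Fin m; the pair (v , w) is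
-- encoded as the element  combine v w : Fin (n * m).
PairSet : ℕ → ℕ → Set
PairSet n m = Subset (n *ℕ m)

_∪⁅_,_⁆ : ∀ {n m} → PairSet n m → Fin n → Fin m → PairSet n m
π ∪⁅ v , w ⁆ = π ∪ ⁅ combine v w ⁆

IsPartialIso : ∀ {n m} → SimpleGraph n → SimpleGraph m → PairSet n m → Set
IsPartialIso G H π =
  ∀ v w v′ w′ → combine v w ∈ π → combine v′ w′ ∈ π →
    ((v ≡ v′) ⇔ (w ≡ w′)) × (adj G v v′ ≡ adj H w w′)

module _ {c ℓ : Level} (R : CommutativeRing c ℓ) where
  open CommutativeRing R hiding (sym)
  open MonoidSum +-monoid using (sum)

  AdjMat : ∀ {n} → SimpleGraph n → Fin n → Fin n → Carrier
  AdjMat G u v = if adj G u v then 1# else 0#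

  EqL1 : ∀ {n m} → ℕ → (PairSet n m → Carrier) → Set ℓ
  EqL1 {n} {m} k X = ∀ (π : PairSet n m) → ∣ π ∣ ≤ k → ∀ (w : Fin m) →
    sum {n} (λ v → X (π ∪⁅ v , w ⁆)) ≈ X π

  EqL2 : ∀ {n m} → ℕ → (PairSet n m → Carrier) → Set ℓ
  EqL2 {n} {m} k X = ∀ (π : PairSet n m) → ∣ π ∣ ≤ k → ∀ (v : Fin n) →
    sum {m} (λ w → X (π ∪⁅ v , w ⁆)) ≈ X π

  EqL3 : ∀ {n m} → SimpleGraph n → SimpleGraph m → ℕ →
         (PairSet n m → Carrier) → Set ℓ
  EqL3 {n} {m} G H k X = ∀ (π : PairSet n m) → ∣ π ∣ ≤ suc k →
    ¬ IsPartialIso G H π → X π ≈ 0#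

  EqL4 : ∀ {n m} → (PairSet n m → Carrier) → Set ℓ
  EqL4 X = X ⊥ ≈ 1#

  EqF : ∀ {n m} → SimpleGraph n → SimpleGraph m → ℕ →
        (PairSet n m → Carrier) → Set ℓ
  EqF {n} {m} G H k X = ∀ (π : PairSet n m) → ∣ π ∣ ≤ k ∸ 1 →
    ∀ (v : Fin n) (w : Fin m) →
    sum {n} (λ v′ → AdjMat G v v′ * X (π ∪⁅ v′ , w ⁆))
      ≈ sum {m} (λ w′ → X (π ∪⁅ v , w′ ⁆) * AdjMat H w′ w)

  -- X is a solution of L^{k+1}_iso(G,H)
  IsSolL : ∀ {n m} → SimpleGraph n → SimpleGraph m → ℕ →
           (PairSet n m → Carrier) → Set ℓ
  IsSolL {n} {m} G H k X =
    EqL1 {n} {m} k X × EqL2 {n} {m} k X × EqL3 G H k X × EqL4 {n} {m} X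

  -- X is a solution of F̃^{k+1/2}_iso(G,H)
  IsSolF : ∀ {n m} → SimpleGraph n → SimpleGraph m → ℕ →
           (PairSet n m → Carrier) → Set ℓ
  IsSolF {n} {m} G H k X =
    EqL1 {n} {m} k X × EqL2 {n} {m} k X × EqL4 {n} {m} X × EqF G H k X

-- Expand X(π ∪ {(v′,w)}) with (L2) over the extra pair (v,w′).  Every summand
-- with A(v,v′) ≠ B(w′,w) is indexed by a set that is not a partial isomorphism,
-- so it vanishes by (L3); hence A(v,v′) may be moved across the summand and
-- replaced by B(w′,w).  Exchanging the two sums and contracting over v′ with
-- (L1) gives the right-hand side of the F̃ equation.
module Submission where

open import Defs hiding (sym)
open import Level using (Level)
open import Data.Nat using (ℕ; _≤_; _<_; suc; _+_; s≤s; z≤n)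
open import Algebra.Bundles using (CommutativeRing; CommutativeMonoid)
open import Data.Nat.Properties using (≤-trans; +-suc; +-comm; n≤1+n; +-monoʳ-≤)
open import Data.Bool using (Bool; true; false; if_then_else_)
open import Data.Fin using (Fin; combine)
open import Data.Fin.Subset using (Subset; _∈_; _∪_; ⁅_⁆; ∣_∣)
open import Data.Fin.Subset.Properties
  using (x∈⁅x⁆; p⊆p∪q; q⊆p∪q; ∣⁅x⁆∣≡1; ∪-commutativeMonoid)
open import Data.Vec using ([]; _∷_)
open import Data.Product using (_,_; proj₂)
open import Relation.Binary.PropositionalEquality as ≡
  using (_≡_; _≢_; cong; subst)
open import Relation.Nullary using (¬_)
import Algebra.Properties.CommutativeSemigroup as CommutativeSemigroupProperties
import Algebra.Properties.CommutativeMonoid.Sum as CommutativeMonoidSum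
import Algebra.Properties.Semiring.Sum as SemiringSum
import Relation.Binary.Reasoning.Setoid as SetoidReasoning

∣p∪q∣≤∣p∣+∣q∣ : ∀ {n} (p q : Subset n) → ∣ p ∪ q ∣ ≤ ∣ p ∣ + ∣ q ∣
∣p∪q∣≤∣p∣+∣q∣ []          []          = z≤n
∣p∪q∣≤∣p∣+∣q∣ (true ∷ p)  (true ∷ q)  =
  s≤s (≤-trans (∣p∪q∣≤∣p∣+∣q∣ p q) (+-monoʳ-≤ ∣ p ∣ (n≤1+n ∣ q ∣)))
∣p∪q∣≤∣p∣+∣q∣ (true ∷ p)  (false ∷ q) = s≤s (∣p∪q∣≤∣p∣+∣q∣ p q)
∣p∪q∣≤∣p∣+∣q∣ (false ∷ p) (true ∷ q)  =
  subst (suc ∣ p ∪ q ∣ ≤_) (≡.sym (+-suc ∣ p ∣ ∣ q ∣)) (s≤s (∣p∪q∣≤∣p∣+∣q∣ p q))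
∣p∪q∣≤∣p∣+∣q∣ (false ∷ p) (false ∷ q) = ∣p∪q∣≤∣p∣+∣q∣ p q

∣p∪⁅x⁆∣≤1+∣p∣ : ∀ {n} (p : Subset n) x → ∣ p ∪ ⁅ x ⁆ ∣ ≤ suc ∣ p ∣
∣p∪⁅x⁆∣≤1+∣p∣ p x =
  subst (∣ p ∪ ⁅ x ⁆ ∣ ≤_) (≡.trans (cong (∣ p ∣ +_) (∣⁅x⁆∣≡1 x)) (+-comm ∣ p ∣ 1))
    (∣p∪q∣≤∣p∣+∣q∣ p ⁅ x ⁆)

∣π∣<k⇒∣π∪⁅v,w⁆∣≤k : ∀ {n m k} (π : PairSet n m) (v : Fin n) (w : Fin m) →
                     ∣ π ∣ < k → ∣ π ∪⁅ v , w ⁆ ∣ ≤ k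
∣π∣<k⇒∣π∪⁅v,w⁆∣≤k π v w = ≤-trans (∣p∪⁅x⁆∣≤1+∣p∣ π (combine v w))

x∈p∪⁅x⁆ : ∀ {n} (p : Subset n) x → x ∈ p ∪ ⁅ x ⁆
x∈p∪⁅x⁆ p x = q⊆p∪q p ⁅ x ⁆ (x∈⁅x⁆ x)

∪⁅⁆-swap : ∀ {n m} (π : PairSet n m) (v : Fin n) (w : Fin m) (v′ : Fin n) (w′ : Fin m) →
           (π ∪⁅ v , w ⁆) ∪⁅ v′ , w′ ⁆ ≡ (π ∪⁅ v′ , w′ ⁆) ∪⁅ v , w ⁆
∪⁅⁆-swap π v w v′ w′ = xy∙z≈xz∙y π ⁅ combine v w ⁆ ⁅ combine v′ w′ ⁆
  where
  open CommutativeSemigroupProperties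
    (CommutativeMonoid.commutativeSemigroup (∪-commutativeMonoid _))

adj-mismatch⇒¬IsPartialIso :
  ∀ {n m} (G : SimpleGraph n) (H : SimpleGraph m) (π : PairSet n m) v w v′ w′ →
  combine v w ∈ π → combine v′ w′ ∈ π → adj G v v′ ≢ adj H w w′ →
  ¬ IsPartialIso G H π
adj-mismatch⇒¬IsPartialIso G H π v w v′ w′ vw∈π v′w′∈π mismatch iso =
  mismatch (proj₂ (iso v w v′ w′ vw∈π v′w′∈π))

module _ {c ℓ : Level} (R : CommutativeRing c ℓ) where
  open CommutativeRing R

  indicator-*-comm : ∀ (b b′ : Bool) x → (b ≢ b′ → x ≈ 0#) →
    (if b then 1# else 0#) * x ≈ x * (if b′ then 1# else 0#)
  indicator-*-comm true  true  x _       = *-comm 1# x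
  indicator-*-comm false false x _       = *-comm 0# x
  indicator-*-comm true  false x x≈0 =
    trans (*-congˡ (x≈0 λ ())) (trans (zeroʳ 1#) (sym (zeroʳ x)))
  indicator-*-comm false true  x x≈0 =
    trans (zeroˡ x) (sym (trans (*-congʳ (x≈0 λ ())) (zeroˡ 1#)))

module _ {c ℓ : Level} (R : CommutativeRing c ℓ) {n m : ℕ}
         (G : SimpleGraph n) (H : SimpleGraph m) (k : ℕ)
         (X : PairSet n m → CommutativeRing.Carrier R) where
  open CommutativeRing R
  open CommutativeMonoidSum +-commutativeMonoid using (∑-comm)
  open SemiringSum semiring using (sum; sum-cong-≋; *-distribˡ-sum; *-distribʳ-sum)
  open SetoidReasoning setoid

  private
    A = AdjMat R G
    B = AdjMat R H

  adjacency-slide : EqL3 R G H k X → ∀ (π : PairSet n m) → ∣ π ∣ < k → ∀ v w v′ w′ →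
    let τ = (π ∪⁅ v′ , w ⁆) ∪⁅ v , w′ ⁆ in A v v′ * X τ ≈ X τ * B w′ w
  adjacency-slide l3 π ∣π∣<k v w v′ w′ =
    indicator-*-comm R (adj G v v′) (adj H w′ w) (X τ) λ mismatch →
      l3 τ (∣π∣<k⇒∣π∪⁅v,w⁆∣≤k (π ∪⁅ v′ , w ⁆) v w′
              (s≤s (∣π∣<k⇒∣π∪⁅v,w⁆∣≤k π v′ w ∣π∣<k)))
        (adj-mismatch⇒¬IsPartialIso G H τ v′ w v w′
          (p⊆p∪q ⁅ combine v w′ ⁆ (x∈p∪⁅x⁆ π (combine v′ w)))
          (x∈p∪⁅x⁆ (π ∪⁅ v′ , w ⁆) (combine v w′))
          λ eq → mismatch (≡.trans (SimpleGraph.sym G v v′)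
                                   (≡.trans eq (SimpleGraph.sym H w w′))))
    where τ = (π ∪⁅ v′ , w ⁆) ∪⁅ v , w′ ⁆

  adjacency-intertwines : EqL1 R {n} {m} k X → EqL2 R {n} {m} k X → EqL3 R G H k X →
    ∀ (π : PairSet n m) → ∣ π ∣ < k → ∀ v w →
    sum (λ v′ → A v v′ * X (π ∪⁅ v′ , w ⁆))
      ≈ sum (λ w′ → X (π ∪⁅ v , w′ ⁆) * B w′ w)
  adjacency-intertwines l1 l2 l3 π ∣π∣<k v w = begin
      sum (λ v′ → A v v′ * X (π ∪⁅ v′ , w ⁆))
    ≈⟨ sum-cong-≋ (λ v′ → *-congˡ (sym (l2 (π ∪⁅ v′ , w ⁆) (extend-≤ v′ w) v))) ⟩
      sum (λ v′ → A v v′ * sum (T v′))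
    ≈⟨ sum-cong-≋ (λ v′ → *-distribˡ-sum (A v v′) (T v′)) ⟩
      sum (λ v′ → sum (λ w′ → A v v′ * T v′ w′))
    ≈⟨ sum-cong-≋ (λ v′ → sum-cong-≋ (adjacency-slide l3 π ∣π∣<k v w v′)) ⟩
      sum (λ v′ → sum (λ w′ → T v′ w′ * B w′ w))
    ≈⟨ ∑-comm (λ v′ w′ → T v′ w′ * B w′ w) ⟩
      sum (λ w′ → sum (λ v′ → T v′ w′ * B w′ w))
    ≈⟨ sum-cong-≋ (λ w′ → sym (*-distribʳ-sum (B w′ w) (λ v′ → T v′ w′))) ⟩
      sum (λ w′ → sum (λ v′ → T v′ w′) * B w′ w)
    ≈⟨ sum-cong-≋ (λ w′ → *-congʳ (contract w′)) ⟩
      sum (λ w′ → X (π ∪⁅ v , w′ ⁆) * B w′ w)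
    ∎
    where
    T : Fin n → Fin m → Carrier
    T v′ w′ = X ((π ∪⁅ v′ , w ⁆) ∪⁅ v , w′ ⁆)

    extend-≤ : ∀ v′ w′ → ∣ π ∪⁅ v′ , w′ ⁆ ∣ ≤ k
    extend-≤ v′ w′ = ∣π∣<k⇒∣π∪⁅v,w⁆∣≤k π v′ w′ ∣π∣<k

    contract : ∀ w′ → sum (λ v′ → T v′ w′) ≈ X (π ∪⁅ v , w′ ⁆)
    contract w′ = trans (sum-cong-≋ λ v′ → reflexive (cong X (∪⁅⁆-swap π v′ w v w′)))
                        (l1 (π ∪⁅ v , w′ ⁆) (extend-≤ v w′) w)

mainTheorem8 : ∀ {c ℓ : Level} (R : CommutativeRing c ℓ) (k : ℕ) → 2 ≤ k →
    ∀ {n m : ℕ} (G : SimpleGraph n) (H : SimpleGraph m)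
    (X : PairSet n m → CommutativeRing.Carrier R) →
    IsSolL R G H k X → IsSolF R G H k X
mainTheorem8 R (suc k) (s≤s _) G H X (l1 , l2 , l3 , l4) =
  l1 , l2 , l4 , λ π ∣π∣≤k → adjacency-intertwines R G H (suc k) X l1 l2 l3 π (s≤s ∣π∣≤k)
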